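{- There exists a function $f:\mathbb N^3\to\mathbb N$ such that $\mathrm{Cut}(G,k)\le f(n,m,k)$ for every graph $G$ such that $\lfloor G\rfloor$ can be ordered by an MSO-formula of the form $\varphi(x,y;\bar P)$ where $\mathrm{qr}(\varphi)\le m$ and $\bar P=\langle P_0,\dots,P_{n-1}\rangle$ are parameters. Furthermore, $f(n,m,k)$ is effectively elementary in the argument $k$, i.e., there exists a computable function $g$ such that $f(n,m,k)\le\exp_{g(n,m)}(k)$.
   Context: Graphs are finite, simple, undirected. For $G=\langle V,E\rangle$, $\lfloor G\rfloor=\langle V,\mathrm{edg}\rangle$. "$\lfloor G\rfloor$ is ordered by $\varphi(x,y;\bar P)$" means $\varphi(x,y;Z_0,\dots,Z_{n-1})$ is an MSO-formula and $P_i\subseteq V$ are sets with $\{(a,b):\lfloor G\rfloor\models\varphi(a,b;\bar P)\}$ a linear order on $V$; $\mathrm{qr}$ is quantifier rank. A graph with ports in $[k]=\{0,\dots,k-1\}$ is a graph with a labelling of its vertices by $[k]$. For $R\subseteq[k]\times[k]$, $G\otimes_R H$ is the disjoint union of $G,H$ plus all edges $(x,y)$ with $x$ in one graph, $y$ in the other, whose port labels form a pair in $R$; $\mathrm{Del}$ deletes port labels. $\mathrm{Cut}(G,k)$ is the maximal $n$ such that there exist nonempty graphs $H_0,\dots,H_{n-1}$ with ports in $[k]$ and $R\subseteq[k]\times[k]$ with $G\cong\mathrm{Del}(H_0\otimes_R\cdots\otimes_R H_{n-1})$. $\exp_0(k)=k$, $\exp_{j+1}(k)=2^{\exp_j(k)}$.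 -}

module Defs where

open import Data.Nat using (ℕ; zero; suc; _+_; _≤_; _<_; _^_; _⊔_)
open import Data.Fin using (Fin; splitAt)
open import Data.Bool using (Bool; true; false; _∨_)
open import Data.Bool.Properties using (∨-comm)
open import Data.Sum using (_⊎_; inj₁; inj₂)
open import Data.Product using (Σ; _×_; _,_)
open import Data.Vec using (Vec; []; _∷_)
open import Data.Vec.Relation.Unary.All using (All)
open import Data.Vec.Functional as VF using (Vector)
open import Relation.Nullary using (¬_)
open import Relation.Binary.PropositionalEquality using (_≡_; refl)
open import Relation.Binary.Structures using (IsTotalOrder)
open import Function.Bundles using (_↔_; Inverse)

record Graph : Set where
  field
    size    : ℕ
    adj     : Fin size → Fin size → Bool
    adj-sym : ∀ x y → adj x y ≡ adj y x
    adj-irr : ∀ x → adj x x ≡ false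
open Graph public

_≅_ : Graph → Graph → Set
G ≅ H = Σ (Fin (size G) ↔ Fin (size H)) λ f →
          ∀ x y → adj G x y ≡ adj H (Inverse.to f x) (Inverse.to f y)

record PGraph (k : ℕ) : Set where
  field
    graph : Graph
    port  : Fin (size graph) → Fin k
open PGraph public

Del : ∀ {k} → PGraph k → Graph
Del = graph

PortRel : ℕ → Set
PortRel k = Fin k → Fin k → Bool

module _ {k : ℕ} (R : PortRel k) (G H : PGraph k) where
  private
    a = size (graph G)
    b = size (graph H)
    -- an edge (x,y) between the two parts whenever (port x, port y) ∈ R
    -- (x in either graph; the graphs are undirected)
    cross : Fin k → Fin k → Bool
    cross p q = R p q ∨ R q p

    adjU : Fin a ⊎ Fin b → Fin a ⊎ Fin b → Bool
    adjU (inj₁ u) (inj₁ v) = adj (graph G) u v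
    adjU (inj₂ u) (inj₂ v) = adj (graph H) u v
    adjU (inj₁ u) (inj₂ v) = cross (port G u) (port H v)
    adjU (inj₂ u) (inj₁ v) = cross (port H u) (port G v)

    adjU-sym : ∀ x y → adjU x y ≡ adjU y x
    adjU-sym (inj₁ u) (inj₁ v) = adj-sym (graph G) u v
    adjU-sym (inj₂ u) (inj₂ v) = adj-sym (graph H) u v
    adjU-sym (inj₁ u) (inj₂ v) = ∨-comm (R (port G u) (port H v)) _
    adjU-sym (inj₂ u) (inj₁ v) = ∨-comm (R (port H u) (port G v)) _

    adjU-irr : ∀ x → adjU x x ≡ false
    adjU-irr (inj₁ u) = adj-irr (graph G) u
    adjU-irr (inj₂ u) = adj-irr (graph H) u

    portU : Fin a ⊎ Fin b → Fin k
    portU (inj₁ u) = port G u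
    portU (inj₂ u) = port H u

  ⊗ : PGraph k
  ⊗ = record
    { graph = record
        { size    = a + b
        ; adj     = λ x y → adjU (splitAt a x) (splitAt a y)
        ; adj-sym = λ x y → adjU-sym (splitAt a x) (splitAt a y)
        ; adj-irr = λ x → adjU-irr (splitAt a x)
        }
    ; port = λ x → portU (splitAt a x)
    }


emptyP : ∀ {k} → PGraph k
emptyP = record
  { graph = record { size = 0 ; adj = λ () ; adj-sym = λ () ; adj-irr = λ () }
  ; port = λ () }

⨂ : ∀ {k c} → PortRel k → Vec (PGraph k) c → PGraph k
⨂ R []       = emptyP
⨂ R (H ∷ Hs) = ⊗ R H (⨂ R Hs)

-- "c ≤ Cut(G,k)": there are nonempty H₀,…,H_{c-1} with ports in [k] and R
-- with G ≅ Del(H₀ ⊗_R ⋯ ⊗_R H_{c-1}).  Cut(G,k) is the maximal such c, so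
-- Cut(G,k) ≤ N  iff  every such c satisfies c ≤ N.
CutWitness : Graph → ℕ → ℕ → Set
CutWitness G k c =
  Σ (Vec (PGraph k) c) λ Hs →
    All (λ H → 0 < size (graph H)) Hs ×
    Σ (PortRel k) λ R → G ≅ Del (⨂ R Hs)

-- MSO over the signature ⟨V, edg⟩.
-- Formula i j : i free first-order variables, j free set variables
-- (de Bruijn indices; index 0 = innermost binder / first free variable).

data Formula (i j : ℕ) : Set where
  edg  : Fin i → Fin i → Formula i j
  eq   : Fin i → Fin i → Formula i j
  mem  : Fin i → Fin j → Formula i j
  neg  : Formula i j → Formula i j
  and  : Formula i j → Formula i j → Formula i j
  or   : Formula i j → Formula i j → Formula i j
  ex₁  : Formula (suc i) j → Formula i j
  all₁ : Formula (suc i) j → Formula i j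
  ex₂  : Formula i (suc j) → Formula i j
  all₂ : Formula i (suc j) → Formula i j

qr : ∀ {i j} → Formula i j → ℕ
qr (edg x y) = 0
qr (eq x y)  = 0
qr (mem x X) = 0
qr (neg φ)   = qr φ
qr (and φ ψ) = qr φ ⊔ qr ψ
qr (or φ ψ)  = qr φ ⊔ qr ψ
qr (ex₁ φ)   = suc (qr φ)
qr (all₁ φ)  = suc (qr φ)
qr (ex₂ φ)   = suc (qr φ)
qr (all₂ φ)  = suc (qr φ)

VSet : Graph → Set
VSet G = Fin (size G) → Bool

Sat : (G : Graph) → ∀ {i j} → Formula i j →
      Vector (Fin (size G)) i → Vector (VSet G) j → Set
Sat G (edg x y) ρ σ = adj G (ρ x) (ρ y) ≡ true
Sat G (eq x y)  ρ σ = ρ x ≡ ρ y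
Sat G (mem x X) ρ σ = σ X (ρ x) ≡ true
Sat G (neg φ)   ρ σ = ¬ Sat G φ ρ σ
Sat G (and φ ψ) ρ σ = Sat G φ ρ σ × Sat G ψ ρ σ
Sat G (or φ ψ)  ρ σ = Sat G φ ρ σ ⊎ Sat G ψ ρ σ
Sat G (ex₁ φ)   ρ σ = Σ (Fin (size G)) λ v → Sat G φ (v VF.∷ ρ) σ
Sat G (all₁ φ)  ρ σ = (v : Fin (size G)) → Sat G φ (v VF.∷ ρ) σ
Sat G (ex₂ φ)   ρ σ = Σ (VSet G) λ S → Sat G φ ρ (S VF.∷ σ)
Sat G (all₂ φ)  ρ σ = (S : VSet G) → Sat G φ ρ (S VF.∷ σ)

OrderedBy : (G : Graph) → ∀ {n} → Formula 2 n → Vector (VSet G) n → Set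
OrderedBy G φ P =
  IsTotalOrder _≡_ (λ a b → Sat G φ (a VF.∷ b VF.∷ VF.[]) P)

OrderableBy : ℕ → ℕ → Graph → Set
OrderableBy n m G =
  Σ (Formula 2 n) λ φ → qr φ ≤ m × Σ (Vector (VSet G) n) λ P → OrderedBy G φ P

exp : ℕ → ℕ → ℕ
exp zero    k = k
exp (suc j) k = 2 ^ exp j k

module Submission where

-- A cut G ≅ Del(H₀ ⊗_R ⋯ ⊗_R H_{c-1}) decomposes the
-- vertices of G into c nonempty blocks, adjacency between different blocks
-- being a fixed function of the two port labels.  The local m-type of a
-- block t under a valuation (vertices outside t hidden, sets seen only on t)
-- is encoded below typeCount m i j k, a number built from k by products,
-- powers and exponentials, hence below a tower exp h k with h independent of
-- k.  Composition lemma ('transfer'): if a permutation of the blocks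
-- preserves all local m-types, the two valuations satisfy the same MSO
-- formulas of rank ≤ m.  If φ(x, y; P̄) orders ⌊G⌋, two different blocks
-- with the same code (types of a member as first or second of two
-- variables) could be swapped, giving φ(a, b) ⇔ φ(b, a) for distinct a, b.
-- So codes are injective and c ≤ codeCount m n k.

open import Defs
open import Data.Nat using (ℕ; zero; suc; _+_; _*_; _^_; _≤_; _<_; _⊔_; z≤n; s≤s; s<s)
open import Data.Nat.Properties
  using (≤-refl; ≤-trans; <⇒≤; +-monoˡ-≤; +-mono-≤; +-identityʳ; *-mono-≤; m^n>0;
         ^-monoʳ-≤; ^-distribˡ-+-*; m≤m⊔n; m≤n⊔m; m⊔n≤o⇒m≤o; m⊔n≤o⇒n≤o;
         module ≤-Reasoning)
open import Data.Fin using (Fin; zero; suc; combine; funToFin; finToFun; _≟_)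
open import Data.Fin.Properties
  using (finToFun-funToFin; 2↔Bool; combine-injective; suc-injective; any?; injective⇒≤)
open import Data.Fin.Permutation
  using (Permutation′; _⟨$⟩ʳ_; _⟨$⟩ˡ_; flip; inverseˡ; inverseʳ; transpose)
open import Data.Bool using (Bool; false; _∧_; _∨_; if_then_else_)
open import Data.Maybe using (Maybe; just; nothing)
open import Data.Empty using (⊥-elim)
open import Data.Product using (Σ; _×_; _,_; proj₁; proj₂)
open import Data.Sum using (inj₁; inj₂)
open import Function using (_∘_)
open import Function.Bundles using (Inverse; _⇔_; mk⇔)
open import Function.Definitions using (Injective)
open import Relation.Nullary using (¬_; Dec; yes; no; does)
open import Relation.Nullary.Decidable using (_×-dec_; does-⇔; dec-true; dec-false)
open import Relation.Binary.Structures using (IsTotalOrder)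
open import Relation.Binary.PropositionalEquality
  using (_≡_; _≗_; refl; sym; trans; cong; cong₂; subst; ≢-sym; module ≡-Reasoning)

-- Encoding finite data as numbers.

funToFin-cong : ∀ {a b} {f g : Fin a → Fin b} → f ≗ g → funToFin f ≡ funToFin g
funToFin-cong {zero}  e = refl
funToFin-cong {suc a} e = cong₂ combine (e zero) (funToFin-cong (e ∘ suc))

funToFin-injective : ∀ {a b} {f g : Fin a → Fin b} → funToFin f ≡ funToFin g → f ≗ g
funToFin-injective {f = f} {g} e x =
  trans (sym (finToFun-funToFin f x)) (trans (cong (λ z → finToFun z x) e) (finToFun-funToFin g x))

encodeSet : ∀ {a} → (Fin a → Bool) → Fin (2 ^ a)
encodeSet S = funToFin (Inverse.from 2↔Bool ∘ S)

decodeSet : ∀ {a} → Fin (2 ^ a) → Fin a → Bool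
decodeSet e = Inverse.to 2↔Bool ∘ finToFun e

decode-encode : ∀ {a} (S : Fin a → Bool) → decodeSet (encodeSet S) ≗ S
decode-encode S x =
  trans (cong (Inverse.to 2↔Bool) (finToFun-funToFin (Inverse.from 2↔Bool ∘ S) x))
        (Inverse.strictlyInverseˡ 2↔Bool (S x))

encodeSet-cong : ∀ {a} {S S' : Fin a → Bool} → S ≗ S' → encodeSet S ≡ encodeSet S'
encodeSet-cong e = funToFin-cong (cong (Inverse.from 2↔Bool) ∘ e)

encodeSet-injective : ∀ {a} {S S' : Fin a → Bool} → encodeSet S ≡ encodeSet S' → S ≗ S'
encodeSet-injective {S = S} {S'} e x =
  trans (sym (decode-encode S x)) (trans (cong (λ z → decodeSet z x) e) (decode-encode S' x))

encodeRel : ∀ {a b} → (Fin a → Fin b → Bool) → Fin ((2 ^ b) ^ a)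
encodeRel r = funToFin (encodeSet ∘ r)

encodeRel-cong : ∀ {a b} {r r' : Fin a → Fin b → Bool} →
                 (∀ x y → r x y ≡ r' x y) → encodeRel r ≡ encodeRel r'
encodeRel-cong e = funToFin-cong (λ x → encodeSet-cong (e x))

encodeRel-injective : ∀ {a b} {r r' : Fin a → Fin b → Bool} →
                      encodeRel r ≡ encodeRel r' → ∀ x y → r x y ≡ r' x y
encodeRel-injective e x = encodeSet-injective (funToFin-injective e x)

-- Splitting an equality of pairs encoded by combine (the sizes are given,
-- as they cannot be recovered from the encoded values).
split : ∀ a b {x x' : Fin a} {y y' : Fin b} → combine x y ≡ combine x' y' → x ≡ x' × y ≡ y'
split a b = combine-injective _ _ _ _

dec-transport : ∀ {p q} {P : Set p} {Q : Set q} (P? : Dec P) (Q? : Dec Q) →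
                does P? ≡ does Q? → P → Q
dec-transport _        (yes q) _  _ = q
dec-transport (yes _)  (no _)  () _
dec-transport (no ¬p)  (no _)  _  p = ⊥-elim (¬p p)

-- Arithmetic of towers exp h k = 2 ^ 2 ^ ⋯ ^ k.

n<2^n : ∀ n → n < 2 ^ n
n<2^n zero    = s≤s z≤n
n<2^n (suc n) = begin-strict
  suc n         <⟨ s<s (n<2^n n) ⟩
  suc (2 ^ n)   ≤⟨ +-monoˡ-≤ (2 ^ n) (m^n>0 2 n) ⟩
  2 ^ n + 2 ^ n ≡⟨ cong (2 ^ n +_) (sym (+-identityʳ (2 ^ n))) ⟩
  2 ^ suc n     ∎
  where open ≤-Reasoning

double≤2^ : ∀ n → n + n ≤ 2 ^ n
double≤2^ zero    = z≤n
double≤2^ (suc n) = begin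
  suc n + suc n ≤⟨ +-mono-≤ (n<2^n n) (n<2^n n) ⟩
  2 ^ n + 2 ^ n ≡⟨ cong (2 ^ n +_) (sym (+-identityʳ (2 ^ n))) ⟩
  2 ^ suc n     ∎
  where open ≤-Reasoning

exp-inflationary : ∀ h k → k ≤ exp h k
exp-inflationary zero    k = ≤-refl
exp-inflationary (suc h) k = ≤-trans (exp-inflationary h k) (<⇒≤ (n<2^n (exp h k)))

exp-monoˡ : ∀ {p q} k → p ≤ q → exp p k ≤ exp q k
exp-monoˡ {q = q} k z≤n     = exp-inflationary q k
exp-monoˡ         k (s≤s h) = ^-monoʳ-≤ 2 (exp-monoˡ k h)

-- A product of two numbers below towers of heights p and q lies below a
-- tower of height p ⊔ q + 2, since x * y ≤ z * z ≤ 2 ^ (z + z) ≤ 2 ^ 2 ^ z.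
*-below-exp : ∀ {x y} p q k → x ≤ exp p k → y ≤ exp q k →
              x * y ≤ exp (suc (suc (p ⊔ q))) k
*-below-exp {x} {y} p q k x≤ y≤ = begin
  x * y         ≤⟨ *-mono-≤ (≤-trans x≤ (exp-monoˡ k (m≤m⊔n p q)))
                            (≤-trans y≤ (exp-monoˡ k (m≤n⊔m p q))) ⟩
  z * z         ≤⟨ *-mono-≤ (<⇒≤ (n<2^n z)) (<⇒≤ (n<2^n z)) ⟩
  2 ^ z * 2 ^ z ≡⟨ sym (^-distribˡ-+-* 2 z z) ⟩
  2 ^ (z + z)   ≤⟨ ^-monoʳ-≤ 2 (double≤2^ z) ⟩
  2 ^ 2 ^ z     ∎
  where
  open ≤-Reasoning
  z = exp (p ⊔ q) k

TowerBounded : (ℕ → ℕ) → Set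
TowerBounded F = Σ ℕ λ h → ∀ k → F k ≤ exp h k

tb-one : TowerBounded (λ _ → 1)
tb-one = 1 , m^n>0 2

tb-suc : TowerBounded suc
tb-suc = 1 , n<2^n

tb-* : ∀ {F H} → TowerBounded F → TowerBounded H → TowerBounded (λ k → F k * H k)
tb-* (p , F≤) (q , H≤) = suc (suc (p ⊔ q)) , λ k → *-below-exp p q k (F≤ k) (H≤ k)

tb-2^ : ∀ {F} → TowerBounded F → TowerBounded (λ k → 2 ^ F k)
tb-2^ (p , F≤) = suc p , λ k → ^-monoʳ-≤ 2 (F≤ k)

tb-^ : ∀ {F} → TowerBounded F → ∀ i → TowerBounded (λ k → F k ^ i)
tb-^ F≤ zero    = tb-one
tb-^ F≤ (suc i) = tb-* F≤ (tb-^ F≤ i)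

-- The number of local m-types of a block with i vertex variables, j set
-- variables and k ports, i.e. the size of the encoding of 'type' in
-- LocalTypes (atomCount is the case m = 0: ports, adjacency, equality and
-- membership of the variables).
atomCount : ℕ → ℕ → ℕ → ℕ
atomCount i j k = suc k ^ i * ((2 ^ i) ^ i * ((2 ^ i) ^ i * (2 ^ j) ^ i))

typeCount : ℕ → ℕ → ℕ → ℕ → ℕ
typeCount zero    i j k = atomCount i j k
typeCount (suc m) i j k = typeCount m i j k * (typeCount m (suc i) j k *
                          (2 ^ typeCount m (suc i) j k * 2 ^ typeCount m i (suc j) k))

typeCount-bounded : ∀ m i j → TowerBounded (typeCount m i j)
typeCount-bounded zero    i j =
  tb-* (tb-^ tb-suc i) (tb-* two^i^i (tb-* two^i^i (tb-^ (tb-^ two j) i)))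
  where
  two = tb-2^ tb-one
  two^i^i = tb-^ (tb-^ two i) i
typeCount-bounded (suc m) i j =
  tb-* (typeCount-bounded m i j)
 (tb-* (typeCount-bounded m (suc i) j)
 (tb-* (tb-2^ (typeCount-bounded m (suc i) j)) (tb-2^ (typeCount-bounded m i (suc j)))))

-- The number of codes of blocks: pairs of local types of a vertex, taken as
-- the first or the second of two variables, with n set parameters.
codeCount : ℕ → ℕ → ℕ → ℕ
codeCount m n k = typeCount m 2 n k * typeCount m 2 n k

codeCount-bounded : ∀ m n → TowerBounded (codeCount m n)
codeCount-bounded m n = tb-* (typeCount-bounded m 2 n) (typeCount-bounded m 2 n)

record Decomposition (G : Graph) (c k : ℕ) : Set where
  field
    block    : Fin (size G) → Fin c
    label    : Fin (size G) → Fin k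
    link     : Fin k → Fin k → Bool
    link-adj : ∀ u v → ¬ block u ≡ block v → adj G u v ≡ link (label u) (label v)

NonemptyBlocks : ∀ {G c k} → Decomposition G c k → Set
NonemptyBlocks {G} D = ∀ t → Σ (Fin (size G)) λ v → Decomposition.block D v ≡ t

pullback : ∀ {G H c k} → G ≅ H → Decomposition H c k → Decomposition G c k
pullback (f , f-adj) D = record
  { block    = block ∘ to
  ; label    = label ∘ to
  ; link     = link
  ; link-adj = λ u v ne → trans (f-adj u v) (link-adj (to u) (to v) ne)
  }
  where
  open Decomposition D
  open Inverse f using (to)

pullback-nonempty : ∀ {G H c k} (iso : G ≅ H) (D : Decomposition H c k) →
                    NonemptyBlocks D → NonemptyBlocks (pullback {G} {H} iso D)
pullback-nonempty (f , _) D nonempty t =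
  from v , trans (cong (Decomposition.block D) (Inverse.strictlyInverseˡ f v)) v-in-t
  where
  open Inverse f using (from)
  v      = proj₁ (nonempty t)
  v-in-t = proj₂ (nonempty t)

module CutDecomposition {k : ℕ} (R : PortRel k) where
  open import Data.Fin using (splitAt; _↑ˡ_; _↑ʳ_; fromℕ<)
  open import Data.Fin.Properties using (splitAt-↑ˡ; splitAt-↑ʳ)
  open import Data.Vec using (Vec; []; _∷_)
  open import Data.Vec.Relation.Unary.All using (All; _∷_)

  blockOf : ∀ {c} (Hs : Vec (PGraph k) c) → Fin (size (graph (⨂ R Hs))) → Fin c
  blockOf (H ∷ Hs) x with splitAt (size (graph H)) x
  ... | inj₁ _ = zero
  ... | inj₂ y = suc (blockOf Hs y)

  blockOf-adj : ∀ {c} (Hs : Vec (PGraph k) c) x y → ¬ blockOf Hs x ≡ blockOf Hs y →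
                let D = ⨂ R Hs in
                adj (graph D) x y ≡ (R (port D x) (port D y) ∨ R (port D y) (port D x))
  blockOf-adj (H ∷ Hs) x y ne with splitAt (size (graph H)) x | splitAt (size (graph H)) y
  ... | inj₁ _ | inj₁ _ = ⊥-elim (ne refl)
  ... | inj₁ _ | inj₂ _ = refl
  ... | inj₂ _ | inj₁ _ = refl
  ... | inj₂ u | inj₂ v = blockOf-adj Hs u v (ne ∘ cong suc)

  ⨂-decomposition : ∀ {c} (Hs : Vec (PGraph k) c) → Decomposition (Del (⨂ R Hs)) c k
  ⨂-decomposition Hs = record
    { block    = blockOf Hs
    ; label    = port (⨂ R Hs)
    ; link     = λ p q → R p q ∨ R q p
    ; link-adj = blockOf-adj Hs
    }

  ⨂-nonempty : ∀ {c} (Hs : Vec (PGraph k) c) → All (λ H → 0 < size (graph H)) Hs →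
               NonemptyBlocks (⨂-decomposition Hs)
  ⨂-nonempty (H ∷ Hs) (H≠∅ ∷ _) zero = x , x-in-H
    where
    x = fromℕ< H≠∅ ↑ˡ size (graph (⨂ R Hs))
    x-in-H : blockOf (H ∷ Hs) x ≡ zero
    x-in-H rewrite splitAt-↑ˡ (size (graph H)) (fromℕ< H≠∅) (size (graph (⨂ R Hs))) = refl
  ⨂-nonempty (H ∷ Hs) (_ ∷ Hs≠∅) (suc t) = x , x-in-t
    where
    y = proj₁ (⨂-nonempty Hs Hs≠∅ t)
    x = size (graph H) ↑ʳ y
    x-in-t : blockOf (H ∷ Hs) x ≡ suc t
    x-in-t rewrite splitAt-↑ʳ (size (graph H)) (size (graph (⨂ R Hs))) y =
      cong suc (proj₂ (⨂-nonempty Hs Hs≠∅ t))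

cut-decomposition : ∀ {G k c} → CutWitness G k c → Σ (Decomposition G c k) NonemptyBlocks
cut-decomposition {G} (Hs , Hs≠∅ , R , iso) =
  pullback iso D , pullback-nonempty {G} iso D (⨂-nonempty Hs Hs≠∅)
  where
  open CutDecomposition R
  D = ⨂-decomposition Hs

-- Local types of the blocks of a decomposition, and the composition lemma.
-- A valuation is seen from block t with all vertices outside t hidden, and
-- set variables are seen only on t.
module LocalTypes {G : Graph} {c k : ℕ} (D : Decomposition G c k) where
  open import Data.Vec.Functional using (Vector; _∷_)
  open import Data.Vec.Functional.Properties using (∷-cong)
  open Decomposition D

  V : Set
  V = Fin (size G)

  visible : Fin c → V → Maybe V
  visible t v = if does (block v ≟ t) then just v else nothing

  visible-yes : ∀ {t v} → block v ≡ t → visible t v ≡ just v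
  visible-yes {t} {v} v∈t with block v ≟ t
  ... | yes _ = refl
  ... | no v∉t = ⊥-elim (v∉t v∈t)

  visible-no : ∀ {t v} → ¬ block v ≡ t → visible t v ≡ nothing
  visible-no {t} {v} v∉t with block v ≟ t
  ... | yes v∈t = ⊥-elim (v∉t v∈t)
  ... | no _ = refl

  view : ∀ {i} → Fin c → Vector V i → Vector (Maybe V) i
  view t ρ = visible t ∘ ρ

  -- Atomic information about possibly hidden vertices: the port of a visible
  -- vertex (0 for a hidden one), adjacency, equality, and membership in a
  -- set as far as block t is concerned.
  portOf : Maybe V → Fin (suc k)
  portOf nothing  = zero
  portOf (just u) = suc (label u)

  adjOf : Maybe V → Maybe V → Bool
  adjOf (just u) (just v) = adj G u v
  adjOf _        _        = false

  eqOf : Maybe V → Maybe V → Bool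
  eqOf (just u) (just v) = does (u ≟ v)
  eqOf _        _        = false

  memOf : Fin c → Maybe V → VSet G → Bool
  memOf t nothing  S = false
  memOf t (just u) S = does (block u ≟ t) ∧ S u

  memOf-yes : ∀ {t u} S → block u ≡ t → memOf t (just u) S ≡ S u
  memOf-yes {t} {u} S u∈t with block u ≟ t
  ... | yes _ = refl
  ... | no u∉t = ⊥-elim (u∉t u∈t)

  atom : ∀ {i j} → Fin c → Vector (Maybe V) i → Vector (VSet G) j → Fin (atomCount i j k)
  atom t ρ σ = combine (funToFin (portOf ∘ ρ))
              (combine (encodeRel λ x y → adjOf (ρ x) (ρ y))
              (combine (encodeRel λ x y → eqOf (ρ x) (ρ y))
                       (encodeRel λ x X → memOf t (ρ x) (σ X))))

  -- The (m+1)-type records the m-type, the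
  -- m-type after adding a hidden vertex, and the sets of m-types reachable
  -- by adding a vertex of block t or an arbitrary set.
  type : ∀ {i j} m → Fin c → Vector (Maybe V) i → Vector (VSet G) j → Fin (typeCount m i j k)

  VertexExtension : ∀ {i j} m → Fin c → Vector (Maybe V) i → Vector (VSet G) j →
                    Fin (typeCount m (suc i) j k) → Set
  VertexExtension m t ρ σ τ = Σ V λ v → block v ≡ t × type m t (just v ∷ ρ) σ ≡ τ

  vertexExtension? : ∀ {i j} m t ρ σ τ → Dec (VertexExtension {i} {j} m t ρ σ τ)
  vertexExtension? m t ρ σ τ = any? λ v → block v ≟ t ×-dec type m t (just v ∷ ρ) σ ≟ τ

  SetExtension : ∀ {i j} m → Fin c → Vector (Maybe V) i → Vector (VSet G) j →
                 Fin (typeCount m i (suc j) k) → Set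
  SetExtension m t ρ σ τ = Σ (Fin (2 ^ size G)) λ e → type m t ρ (decodeSet e ∷ σ) ≡ τ

  setExtension? : ∀ {i j} m t ρ σ τ → Dec (SetExtension {i} {j} m t ρ σ τ)
  setExtension? m t ρ σ τ = any? λ e → type m t ρ (decodeSet e ∷ σ) ≟ τ

  type zero    t ρ σ = atom t ρ σ
  type (suc m) t ρ σ =
    combine (type m t ρ σ)
   (combine (type m t (nothing ∷ ρ) σ)
   (combine (encodeSet λ τ → does (vertexExtension? m t ρ σ τ))
            (encodeSet λ τ → does (setExtension? m t ρ σ τ))))

  module _ {i j} {t t' : Fin c} {ρ ρ' : Vector (Maybe V) i} {σ σ' : Vector (VSet G) j} where

    record SameAtoms : Set where
      field
        same-port : ∀ x → portOf (ρ x) ≡ portOf (ρ' x)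
        same-adj  : ∀ x y → adjOf (ρ x) (ρ y) ≡ adjOf (ρ' x) (ρ' y)
        same-eq   : ∀ x y → eqOf (ρ x) (ρ y) ≡ eqOf (ρ' x) (ρ' y)
        same-mem  : ∀ x X → memOf t (ρ x) (σ X) ≡ memOf t' (ρ' x) (σ' X)

    atom-injective : atom t ρ σ ≡ atom t' ρ' σ' → SameAtoms
    atom-injective e₀ = record
      { same-port = funToFin-injective e-port
      ; same-adj  = encodeRel-injective e-adj
      ; same-eq   = encodeRel-injective e-eq
      ; same-mem  = encodeRel-injective e-mem
      }
      where
      e₁ = proj₂ (split (suc k ^ i) _ e₀)
      e₂ = proj₂ (split ((2 ^ i) ^ i) _ e₁)
      e-port = proj₁ (split (suc k ^ i) _ e₀)
      e-adj  = proj₁ (split ((2 ^ i) ^ i) _ e₁)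
      e-eq   = proj₁ (split ((2 ^ i) ^ i) _ e₂)
      e-mem  = proj₂ (split ((2 ^ i) ^ i) _ e₂)

    record SameSteps (m : ℕ) : Set where
      field
        same-below   : type m t ρ σ ≡ type m t' ρ' σ'
        same-hidden  : type m t (nothing ∷ ρ) σ ≡ type m t' (nothing ∷ ρ') σ'
        vertex-forth : ∀ τ → VertexExtension m t ρ σ τ → VertexExtension m t' ρ' σ' τ
        set-forth    : ∀ τ → SetExtension m t ρ σ τ → SetExtension m t' ρ' σ' τ

    step-injective : ∀ m → type (suc m) t ρ σ ≡ type (suc m) t' ρ' σ' → SameSteps m
    step-injective m e₀ = record
      { same-below   = proj₁ (split (typeCount m i j k) _ e₀)
      ; same-hidden  = proj₁ (split (typeCount m (suc i) j k) _ e₁)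
      ; vertex-forth = λ τ → dec-transport (vertexExtension? m t ρ σ τ)
                                           (vertexExtension? m t' ρ' σ' τ)
                                           (encodeSet-injective e-vertex τ)
      ; set-forth    = λ τ → dec-transport (setExtension? m t ρ σ τ)
                                           (setExtension? m t' ρ' σ' τ)
                                           (encodeSet-injective e-set τ)
      }
      where
      e₁ = proj₂ (split (typeCount m i j k) _ e₀)
      e₂ = proj₂ (split (typeCount m (suc i) j k) _ e₁)
      e-vertex = proj₁ (split (2 ^ typeCount m (suc i) j k) _ e₂)
      e-set    = proj₂ (split (2 ^ typeCount m (suc i) j k) _ e₂)

    type-atoms : ∀ m → type m t ρ σ ≡ type m t' ρ' σ' → SameAtoms
    type-atoms zero    e = atom-injective e
    type-atoms (suc m) e = type-atoms m (SameSteps.same-below (step-injective m e))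

  AgreeOn : ∀ {j} → Fin c → Vector (VSet G) j → Vector (VSet G) j → Set
  AgreeOn t σ σ' = ∀ X v → block v ≡ t → σ X v ≡ σ' X v

  agree-∷ : ∀ {j t} {σ σ' : Vector (VSet G) j} S →
            AgreeOn t σ σ' → AgreeOn t (S ∷ σ) (S ∷ σ')
  agree-∷ S agree zero    v _   = refl
  agree-∷ S agree (suc X) v v∈t = agree X v v∈t

  memOf-agree : ∀ {t S S'} → (∀ v → block v ≡ t → S v ≡ S' v) →
                ∀ a → memOf t a S ≡ memOf t a S'
  memOf-agree     agree nothing = refl
  memOf-agree {t} agree (just u) with block u ≟ t
  ... | yes u∈t = agree u u∈t
  ... | no _    = refl

  atom-cong : ∀ {i j t} {ρ ρ' : Vector (Maybe V) i} {σ σ' : Vector (VSet G) j} →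
              ρ ≗ ρ' → AgreeOn t σ σ' → atom t ρ σ ≡ atom t ρ' σ'
  atom-cong {t = t} {ρ} {ρ'} {σ} eρ eσ =
    cong₂ combine (funToFin-cong (cong portOf ∘ eρ))
   (cong₂ combine (encodeRel-cong λ x y → cong₂ adjOf (eρ x) (eρ y))
   (cong₂ combine (encodeRel-cong λ x y → cong₂ eqOf (eρ x) (eρ y))
                  (encodeRel-cong λ x X → trans (cong (λ a → memOf t a (σ X)) (eρ x))
                                               (memOf-agree (eσ X) (ρ' x)))))

  type-cong : ∀ {i j} m t {ρ ρ' : Vector (Maybe V) i} {σ σ' : Vector (VSet G) j} →
              ρ ≗ ρ' → AgreeOn t σ σ' → type m t ρ σ ≡ type m t ρ' σ'
  type-cong zero    t eρ eσ = atom-cong eρ eσ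
  type-cong (suc m) t {ρ} {ρ'} {σ} {σ'} eρ eσ =
    cong₂ combine (type-cong m t eρ eσ)
   (cong₂ combine (type-cong m t (∷-cong refl eρ) eσ)
   (cong₂ combine (encodeSet-cong λ τ → does-⇔ (vertex-⇔ τ) (vertexExtension? m t ρ σ τ)
                                                             (vertexExtension? m t ρ' σ' τ))
                  (encodeSet-cong λ τ → does-⇔ (set-⇔ τ) (setExtension? m t ρ σ τ)
                                                          (setExtension? m t ρ' σ' τ))))
    where
    same-vertex : ∀ v → type m t (just v ∷ ρ) σ ≡ type m t (just v ∷ ρ') σ'
    same-vertex v = type-cong m t (∷-cong refl eρ) eσ

    same-set : ∀ S → type m t ρ (S ∷ σ) ≡ type m t ρ' (S ∷ σ')
    same-set S = type-cong m t eρ (agree-∷ S eσ)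

    vertex-⇔ : ∀ τ → VertexExtension m t ρ σ τ ⇔ VertexExtension m t ρ' σ' τ
    vertex-⇔ τ = mk⇔ (λ (v , v∈t , e) → v , v∈t , trans (sym (same-vertex v)) e)
                     (λ (v , v∈t , e) → v , v∈t , trans (same-vertex v) e)

    set-⇔ : ∀ τ → SetExtension m t ρ σ τ ⇔ SetExtension m t ρ' σ' τ
    set-⇔ τ = mk⇔ (λ (e , p) → e , trans (sym (same-set (decodeSet e))) p)
                  (λ (e , p) → e , trans (same-set (decodeSet e)) p)

  record Matched {i j} (π : Permutation′ c) (m : ℕ) (ρ : Vector V i) (σ : Vector (VSet G) j)
                 (ρ' : Vector V i) (σ' : Vector (VSet G) j) : Set where
    constructor matching
    field
      same-type : ∀ t → type m t (view t ρ) σ ≡ type m (π ⟨$⟩ʳ t) (view (π ⟨$⟩ʳ t) ρ') σ'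
  open Matched

  private
    variable
      i j m : ℕ
      π     : Permutation′ c
      ρ ρ'  : Vector V i
      σ σ'  : Vector (VSet G) j

  π-injective : ∀ (π : Permutation′ c) {s t} → π ⟨$⟩ʳ s ≡ π ⟨$⟩ʳ t → s ≡ t
  π-injective π e = trans (sym (inverseˡ π)) (trans (cong (π ⟨$⟩ˡ_) e) (inverseˡ π))

  matched-sym : Matched π m ρ σ ρ' σ' → Matched (flip π) m ρ' σ' ρ σ
  matched-sym {π = π} {m = m} {ρ = ρ} {σ = σ} {ρ' = ρ'} {σ' = σ'} matched = matching λ t →
    sym (subst (λ s → type m (π ⟨$⟩ˡ t) (view (π ⟨$⟩ˡ t) ρ) σ ≡ type m s (view s ρ') σ')
               (inverseʳ π) (same-type matched (π ⟨$⟩ˡ t)))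

  visible-port : ∀ {t v a} → portOf (visible t v) ≡ suc a → block v ≡ t × label v ≡ a
  visible-port {t} {v} e with block v ≟ t
  ... | yes v∈t = v∈t , suc-injective e
  ... | no _ with () ← e

  module _ (matched : Matched π m ρ σ ρ' σ') where
    private
      atoms : ∀ t → SameAtoms
      atoms t = type-atoms m (same-type matched t)
      open module Atoms t = SameAtoms (atoms t)

    matched-position : ∀ x → block (ρ' x) ≡ π ⟨$⟩ʳ block (ρ x) × label (ρ' x) ≡ label (ρ x)
    matched-position x = visible-port (begin
      portOf (view (π ⟨$⟩ʳ t) ρ' x) ≡⟨ sym (same-port t x) ⟩
      portOf (view t ρ x)           ≡⟨ cong portOf (visible-yes refl) ⟩
      suc (label (ρ x))             ∎)
      where
      open ≡-Reasoning
      t = block (ρ x)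

    visible-right : ∀ {t y} → block (ρ y) ≡ t → view (π ⟨$⟩ʳ t) ρ' y ≡ just (ρ' y)
    visible-right e = visible-yes (trans (proj₁ (matched-position _)) (cong (π ⟨$⟩ʳ_) e))

    matched-adj : ∀ x y → adj G (ρ x) (ρ y) ≡ adj G (ρ' x) (ρ' y)
    matched-adj x y with block (ρ x) ≟ block (ρ y)
    ... | yes same = begin
      adjOf (just (ρ x)) (just (ρ y))
        ≡⟨ sym (cong₂ adjOf (visible-yes refl) (visible-yes (sym same))) ⟩
      adjOf (view t ρ x) (view t ρ y)
        ≡⟨ same-adj t x y ⟩
      adjOf (view (π ⟨$⟩ʳ t) ρ' x) (view (π ⟨$⟩ʳ t) ρ' y)
        ≡⟨ cong₂ adjOf (visible-right refl) (visible-right (sym same)) ⟩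
      adjOf (just (ρ' x)) (just (ρ' y))
        ∎
      where
      open ≡-Reasoning
      t = block (ρ x)
    ... | no differ = begin
      adj G (ρ x) (ρ y)
        ≡⟨ link-adj _ _ differ ⟩
      link (label (ρ x)) (label (ρ y))
        ≡⟨ sym (cong₂ link (proj₂ (matched-position x)) (proj₂ (matched-position y))) ⟩
      link (label (ρ' x)) (label (ρ' y))
        ≡⟨ sym (link-adj _ _ differ') ⟩
      adj G (ρ' x) (ρ' y)
        ∎
      where
      open ≡-Reasoning
      differ' : ¬ block (ρ' x) ≡ block (ρ' y)
      differ' e = differ (π-injective π (trans (sym (proj₁ (matched-position x)))
                                               (trans e (proj₁ (matched-position y)))))

    matched-eq : ∀ x y → ρ x ≡ ρ y → ρ' x ≡ ρ' y
    matched-eq x y e = dec-transport (ρ x ≟ ρ y) (ρ' x ≟ ρ' y) same-answer e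
      where
      open ≡-Reasoning
      t = block (ρ x)
      same : block (ρ y) ≡ t
      same = cong block (sym e)
      same-answer : does (ρ x ≟ ρ y) ≡ does (ρ' x ≟ ρ' y)
      same-answer = begin
        eqOf (just (ρ x)) (just (ρ y))
          ≡⟨ sym (cong₂ eqOf (visible-yes refl) (visible-yes same)) ⟩
        eqOf (view t ρ x) (view t ρ y)
          ≡⟨ same-eq t x y ⟩
        eqOf (view (π ⟨$⟩ʳ t) ρ' x) (view (π ⟨$⟩ʳ t) ρ' y)
          ≡⟨ cong₂ eqOf (visible-right refl) (visible-right same) ⟩
        eqOf (just (ρ' x)) (just (ρ' y))
          ∎

    matched-mem : ∀ x X → σ X (ρ x) ≡ σ' X (ρ' x)
    matched-mem x X = begin
      σ X (ρ x)                      ≡⟨ sym (memOf-yes (σ X) refl) ⟩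
      memOf t (just (ρ x)) (σ X)     ≡⟨ cong (λ a → memOf t a (σ X)) (sym (visible-yes refl)) ⟩
      memOf t (view t ρ x) (σ X)     ≡⟨ same-mem t x X ⟩
      memOf t' (view t' ρ' x) (σ' X) ≡⟨ cong (λ a → memOf t' a (σ' X)) (visible-right refl) ⟩
      memOf t' (just (ρ' x)) (σ' X)  ≡⟨ memOf-yes (σ' X) (proj₁ (matched-position x)) ⟩
      σ' X (ρ' x)                    ∎
      where
      open ≡-Reasoning
      t  = block (ρ x)
      t' = π ⟨$⟩ʳ t

  view-∷-visible : ∀ m {t v} → block v ≡ t →
                   type m t (view t (v ∷ ρ)) σ ≡ type m t (just v ∷ view t ρ) σ
  view-∷-visible m {t} v∈t =
    type-cong m t (∷-cong (visible-yes v∈t) (λ _ → refl)) (λ _ _ _ → refl)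

  view-∷-hidden : ∀ m {t v} → ¬ block v ≡ t →
                  type m t (view t (v ∷ ρ)) σ ≡ type m t (nothing ∷ view t ρ) σ
  view-∷-hidden m {t} v∉t =
    type-cong m t (∷-cong (visible-no v∉t) (λ _ → refl)) (λ _ _ _ → refl)

  -- Forth step for a vertex: a vertex added on the left, in block t, is
  -- answered by a vertex of block π t with the same local type; all other
  -- blocks just see one more hidden vertex.
  matched-vertex : Matched π (suc m) ρ σ ρ' σ' →
                   ∀ v → Σ V λ v' → Matched π m (v ∷ ρ) σ (v' ∷ ρ') σ'
  matched-vertex {π = π} {m = m} {ρ = ρ} {σ = σ} {ρ' = ρ'} {σ' = σ'} matched v =
    v' , matching extended
    where
    open ≡-Reasoning
    steps : ∀ t → SameSteps m
    steps t = step-injective m (same-type matched t)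

    answer : VertexExtension m (π ⟨$⟩ʳ block v) (view (π ⟨$⟩ʳ block v) ρ') σ'
                             (type m (block v) (just v ∷ view (block v) ρ) σ)
    answer = SameSteps.vertex-forth (steps (block v)) _ (v , refl , refl)

    v' = proj₁ answer
    v'-block = proj₁ (proj₂ answer)
    v'-type  = proj₂ (proj₂ answer)

    extended : ∀ t → type m t (view t (v ∷ ρ)) σ
                   ≡ type m (π ⟨$⟩ʳ t) (view (π ⟨$⟩ʳ t) (v' ∷ ρ')) σ'
    extended t with block v ≟ t
    ... | yes refl = begin
      type m t (view t (v ∷ ρ)) σ                   ≡⟨ view-∷-visible m refl ⟩
      type m t (just v ∷ view t ρ) σ                ≡⟨ sym v'-type ⟩
      type m t' (just v' ∷ view t' ρ') σ'           ≡⟨ sym (view-∷-visible m v'-block) ⟩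
      type m t' (view t' (v' ∷ ρ')) σ'              ∎
      where t' = π ⟨$⟩ʳ t
    ... | no v∉t = begin
      type m t (view t (v ∷ ρ)) σ                   ≡⟨ view-∷-hidden m v∉t ⟩
      type m t (nothing ∷ view t ρ) σ               ≡⟨ SameSteps.same-hidden (steps t) ⟩
      type m t' (nothing ∷ view t' ρ') σ'           ≡⟨ sym (view-∷-hidden m v'∉t') ⟩
      type m t' (view t' (v' ∷ ρ')) σ'              ∎
      where
      t' = π ⟨$⟩ʳ t
      v'∉t' : ¬ block v' ≡ t'
      v'∉t' e = v∉t (π-injective π (trans (sym v'-block) e))

  -- Forth step for a set: each block t picks a set whose trace on block π t
  -- answers the trace of S on t, and these traces are glued into one set S'.
  matched-set : Matched π (suc m) ρ σ ρ' σ' →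
                ∀ S → Σ (VSet G) λ S' → Matched π m ρ (S ∷ σ) ρ' (S' ∷ σ')
  matched-set {π = π} {m = m} {ρ = ρ} {σ = σ} {ρ' = ρ'} {σ' = σ'} matched S =
    S' , matching extended
    where
    open ≡-Reasoning
    S-code : ∀ t → type m t (view t ρ) (decodeSet (encodeSet S) ∷ σ) ≡ type m t (view t ρ) (S ∷ σ)
    S-code t = type-cong m t (λ _ → refl)
                 λ { zero v _ → decode-encode S v ; (suc X) v _ → refl }

    answer : ∀ t → SetExtension m (π ⟨$⟩ʳ t) (view (π ⟨$⟩ʳ t) ρ') σ'
                                (type m t (view t ρ) (S ∷ σ))
    answer t = SameSteps.set-forth (step-injective m (same-type matched t)) _
                                   (encodeSet S , S-code t)

    S' : VSet G
    S' v = decodeSet (proj₁ (answer (π ⟨$⟩ˡ block v))) v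

    glued : ∀ t → AgreeOn (π ⟨$⟩ʳ t) (decodeSet (proj₁ (answer t)) ∷ σ') (S' ∷ σ')
    glued t zero    v v∈t' = cong (λ s → decodeSet (proj₁ (answer s)) v)
                                  (sym (trans (cong (π ⟨$⟩ˡ_) v∈t') (inverseˡ π)))
    glued t (suc X) v _    = refl

    extended : ∀ t → type m t (view t ρ) (S ∷ σ)
                   ≡ type m (π ⟨$⟩ʳ t) (view (π ⟨$⟩ʳ t) ρ') (S' ∷ σ')
    extended t = begin
      type m t (view t ρ) (S ∷ σ)
        ≡⟨ proj₂ (answer t) ⟨
      type m t' (view t' ρ') (decodeSet (proj₁ (answer t)) ∷ σ')
        ≡⟨ type-cong m t' (λ _ → refl) (glued t) ⟩
      type m t' (view t' ρ') (S' ∷ σ')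
        ∎
      where t' = π ⟨$⟩ʳ t

  -- Composition lemma: matched valuations satisfy the same formulas of
  -- quantifier rank at most m (an Ehrenfeucht–Fraïssé argument by induction
  -- on the formula).
  transfer : (φ : Formula i j) (π : Permutation′ c) (m : ℕ) → qr φ ≤ m →
             Matched π m ρ σ ρ' σ' → Sat G φ ρ σ → Sat G φ ρ' σ'
  transfer (edg x y) π m _ matched s = trans (sym (matched-adj matched x y)) s
  transfer (eq x y)  π m _ matched s = matched-eq matched x y s
  transfer (mem x X) π m _ matched s = trans (sym (matched-mem matched x X)) s
  transfer (neg φ)   π m q matched s = λ s' → s (transfer φ (flip π) m q (matched-sym matched) s')
  transfer (and φ ψ) π m q matched (s₁ , s₂) =
    transfer φ π m (m⊔n≤o⇒m≤o (qr φ) (qr ψ) q) matched s₁ ,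
    transfer ψ π m (m⊔n≤o⇒n≤o (qr φ) (qr ψ) q) matched s₂
  transfer (or φ ψ)  π m q matched (inj₁ s) =
    inj₁ (transfer φ π m (m⊔n≤o⇒m≤o (qr φ) (qr ψ) q) matched s)
  transfer (or φ ψ)  π m q matched (inj₂ s) =
    inj₂ (transfer ψ π m (m⊔n≤o⇒n≤o (qr φ) (qr ψ) q) matched s)
  transfer (ex₁ φ)  π (suc m) (s≤s q) matched (v , s) =
    let v' , matched' = matched-vertex matched v in v' , transfer φ π m q matched' s
  transfer (all₁ φ) π (suc m) (s≤s q) matched s v' =
    let v , matched' = matched-vertex (matched-sym matched) v'
    in transfer φ (flip (flip π)) m q (matched-sym matched') (s v)
  transfer (ex₂ φ)  π (suc m) (s≤s q) matched (S , s) =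
    let S' , matched' = matched-set matched S in S' , transfer φ π m q matched' s
  transfer (all₂ φ) π (suc m) (s≤s q) matched s S' =
    let S , matched' = matched-set (matched-sym matched) S'
    in transfer φ (flip (flip π)) m q (matched-sym matched') (s S)

total-symmetric : ∀ {A : Set} {_≼_ : A → A → Set} → IsTotalOrder _≡_ _≼_ →
                  ∀ {a b} → (a ≼ b → b ≼ a) → (b ≼ a → a ≼ b) → a ≡ b
total-symmetric order {a} {b} ab⇒ba ba⇒ab with IsTotalOrder.total order a b
... | inj₁ a≼b = IsTotalOrder.antisym order a≼b (ab⇒ba a≼b)
... | inj₂ b≼a = IsTotalOrder.antisym order (ba⇒ab b≼a) b≼a

transpose-left : ∀ {c} (s t : Fin c) → transpose s t ⟨$⟩ʳ s ≡ t
transpose-left s t rewrite dec-true (s ≟ s) refl = refl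

transpose-right : ∀ {c} (s t : Fin c) → transpose s t ⟨$⟩ʳ t ≡ s
transpose-right s t with t ≟ s
... | yes t≡s = t≡s
... | no t≢s rewrite dec-true (t ≟ t) refl = refl

transpose-other : ∀ {c} {s t r : Fin c} → ¬ r ≡ s → ¬ r ≡ t → transpose s t ⟨$⟩ʳ r ≡ r
transpose-other {s = s} {t} {r} r≢s r≢t
  rewrite dec-false (r ≟ s) r≢s | dec-false (r ≟ t) r≢t = refl

module FewBlocks {G : Graph} {c k : ℕ} (D : Decomposition G c k) (nonempty : NonemptyBlocks D) where
  open import Data.Vec.Functional using (Vector; _∷_; [])
  open Decomposition D
  open LocalTypes D
  open Matched

  member : Fin c → V
  member t = proj₁ (nonempty t)

  sees : ∀ {r s} → r ≡ s → visible r (member s) ≡ just (member s)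
  sees {s = s} r≡s = visible-yes (trans (proj₂ (nonempty s)) (sym r≡s))

  misses : ∀ {r s} → ¬ r ≡ s → visible r (member s) ≡ nothing
  misses {s = s} r≢s = visible-no λ e → r≢s (trans (sym e) (proj₂ (nonempty s)))

  module _ {n} (m : ℕ) (P : Vector (VSet G) n) where
    pairType : Fin c → Maybe V → Maybe V → Fin (typeCount m 2 n k)
    pairType r x y = type m r (x ∷ y ∷ []) P

    view-pair : ∀ r u w →
                type m r (view r (u ∷ w ∷ [])) P ≡ pairType r (visible r u) (visible r w)
    view-pair r u w = type-cong m r (λ { zero → refl ; (suc zero) → refl }) (λ _ _ _ → refl)

    code : Fin c → Fin (codeCount m n k)
    code t = combine (pairType t (just (member t)) nothing) (pairType t nothing (just (member t)))

    swap-matched : ∀ {s t} → ¬ s ≡ t → code s ≡ code t →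
                   Matched (transpose s t) m (member s ∷ member t ∷ []) P
                                             (member t ∷ member s ∷ []) P
    swap-matched {s} {t} s≢t same-code = matching λ r → begin
      type m r (view r (a ∷ b ∷ [])) P           ≡⟨ view-pair r a b ⟩
      pairType r (visible r a) (visible r b)     ≡⟨ swapped r (r ≟ s) (r ≟ t) ⟩
      pairType (τ ⟨$⟩ʳ r) (visible (τ ⟨$⟩ʳ r) b) (visible (τ ⟨$⟩ʳ r) a)
                                                 ≡⟨ sym (view-pair (τ ⟨$⟩ʳ r) b a) ⟩
      type m (τ ⟨$⟩ʳ r) (view (τ ⟨$⟩ʳ r) (b ∷ a ∷ [])) P ∎
      where
      open ≡-Reasoning
      a = member s
      b = member t
      τ = transpose s t
      first  = proj₁ (split (typeCount m 2 n k) (typeCount m 2 n k) same-code)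
      second = proj₂ (split (typeCount m 2 n k) (typeCount m 2 n k) same-code)

      Swapped : Fin c → Fin c → Set
      Swapped r r' = pairType r (visible r a) (visible r b) ≡ pairType r' (visible r' b) (visible r' a)

      swapped-to : ∀ {r r'} → τ ⟨$⟩ʳ r ≡ r' → Swapped r r' → Swapped r (τ ⟨$⟩ʳ r)
      swapped-to refl e = e

      -- The decisions are passed as arguments: a 'with' on r ≟ s would also
      -- abstract it inside τ ⟨$⟩ʳ r, which is computed from r ≟ s.
      swapped : ∀ r → Dec (r ≡ s) → Dec (r ≡ t) → Swapped r (τ ⟨$⟩ʳ r)
      swapped .s (yes refl) _ = swapped-to (transpose-left s t) (begin
        pairType s (visible s a) (visible s b) ≡⟨ cong₂ (pairType s) (sees refl) (misses s≢t) ⟩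
        pairType s (just a) nothing            ≡⟨ first ⟩
        pairType t (just b) nothing            ≡⟨ cong₂ (pairType t) (sees refl) (misses (≢-sym s≢t)) ⟨
        pairType t (visible t b) (visible t a) ∎)
      swapped .t (no t≢s) (yes refl) = swapped-to (transpose-right s t) (begin
        pairType t (visible t a) (visible t b) ≡⟨ cong₂ (pairType t) (misses t≢s) (sees refl) ⟩
        pairType t nothing (just b)            ≡⟨ second ⟨
        pairType s nothing (just a)            ≡⟨ cong₂ (pairType s) (misses s≢t) (sees refl) ⟨
        pairType s (visible s b) (visible s a) ∎)
      swapped r (no r≢s) (no r≢t) = swapped-to (transpose-other r≢s r≢t) (begin
        pairType r (visible r a) (visible r b) ≡⟨ cong₂ (pairType r) (misses r≢s) (misses r≢t) ⟩
        pairType r nothing nothing             ≡⟨ cong₂ (pairType r) (misses r≢t) (misses r≢s) ⟨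
        pairType r (visible r b) (visible r a) ∎)

    -- If φ(x, y; P) orders G, different blocks have different codes: otherwise
    -- φ could not distinguish (a, b) from (b, a) for their members a ≠ b.
    code-injective : (φ : Formula 2 n) → qr φ ≤ m → OrderedBy G φ P → Injective _≡_ _≡_ code
    code-injective φ q ordered {s} {t} same-code with s ≟ t
    ... | yes s≡t = s≡t
    ... | no s≢t = ⊥-elim (s≢t (begin
      s                  ≡⟨ sym (proj₂ (nonempty s)) ⟩
      block (member s)   ≡⟨ cong block (total-symmetric ordered forth back) ⟩
      block (member t)   ≡⟨ proj₂ (nonempty t) ⟩
      t                  ∎))
      where
      open ≡-Reasoning
      τ = transpose s t
      swap = swap-matched s≢t same-code
      forth = transfer φ τ m q swap
      back  = transfer φ (flip τ) m q (matched-sym swap)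

  blocks-bound : ∀ {n m} (φ : Formula 2 n) → qr φ ≤ m → (P : Vector (VSet G) n) →
                 OrderedBy G φ P → c ≤ codeCount m n k
  blocks-bound {m = m} φ q P ordered = injective⇒≤ (code-injective m P φ q ordered)

cut-bound : (n m k : ℕ) (G : Graph) → OrderableBy n m G →
            (c : ℕ) → CutWitness G k c → c ≤ codeCount m n k
cut-bound n m k G (φ , qr≤m , P , ordered) c cut =
  FewBlocks.blocks-bound D nonempty φ qr≤m P ordered
  where
  D        = proj₁ (cut-decomposition {G} cut)
  nonempty = proj₂ (cut-decomposition {G} cut)

proposition5p7 :
    Σ (ℕ → ℕ → ℕ → ℕ) λ f →
      ((n m k : ℕ) (G : Graph) → OrderableBy n m G →
         (c : ℕ) → CutWitness G k c → c ≤ f n m k)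
      × Σ (ℕ → ℕ → ℕ) λ g → (n m k : ℕ) → f n m k ≤ exp (g n m) k
proposition5p7 =
  (λ n m → codeCount m n) , cut-bound ,
  (λ n m → proj₁ (codeCount-bounded m n)) , (λ n m → proj₂ (codeCount-bounded m n))
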